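{- Let $G$ be a modified planar graph with $m$ edges and let $\mathcal{T}$ be a separator tree of $G$. Let $\mathcal{H}$ be a set of $K$ nodes in $\mathcal{T}$. Then \[\sum_{H\in\mathcal{P}_{\mathcal{T}}(\mathcal{H})}|\partial H|+|F_H|\le \widetilde{O}(\sqrt{mK}).\]
   Context: A modified planar graph is a graph obtained from a planar graph by adding two new vertices and any number of edges incident to them (parallel edges allowed). Such a graph is $1/2$-separable: there are constants $c>0$, $b\in(0,1)$ such that every subgraph $H$ with $|E(H)|\ge2$ can be split into edge-disjoint $H_1,H_2$ with $E(H_1)\cup E(H_2)=E(H)$, $|V(H_1)\cap V(H_2)|\le c\lceil|E(H)|^{1/2}\rceil$ and $|E(H_i)|\le b|E(H)|$. A separator tree $\mathcal{T}$ of $G$ is a rooted binary tree whose nodes are regions (edge-induced subgraphs) $H$ of $G$, each storing vertex sets $\partial H$ (boundary), $S(H)$ (separator), $F_H$ (eliminated vertices), defined recursively: the root is $G$ with $\partial G=\emptyset$ and $F_G=S(G)$; a non-leaf node $H$ has two children $D_1,D_2$ forming a partition of $H$ as in the separability definition, with $V(D_1)\cap V(D_2)=S(H)$ being the balanced separator of $H$, $\partial D_j=(\partial H\cup S(H))\cap V(D_j)$, and $F_H=S(H)\setminus\partial H$; a node with a constant number of edges is a leaf, with $S(H)=\emptyset$ and $F_H=V(H)\setminus\partial H$. The tree has height $O(\log m)$. For a set $\mathcal{H}$ of nodes, $\mathcal{P}_{\mathcal{T}}(\mathcal{H})$ is the set of all nodes lying on a tree path from some $H\in\mathcal{H}$ to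 the root (including $H$). $\widetilde{O}$ hides polylogarithmic factors in $m$. -}

module Defs where

open import Data.Nat using (ℕ; zero; suc; _+_; _*_; _≤_; _<_)
open import Data.Bool using (Bool; true; false; not; _∧_; _∨_; if_then_else_)
open import Data.Fin using (Fin; _↑ˡ_)
open import Data.Fin.Properties using () renaming (_≟_ to _≟ᶠ_)
open import Data.Fin.Subset using (Subset; ⊥; ⊤; _∩_; _∪_; _─_; ∣_∣)
open import Data.Vec using (tabulate)
open import Data.List using (List; []; _∷_; length; lookup; map; _++_; filterᵇ; sum)
open import Data.List.Membership.Propositional using (_∈_)
open import Data.Product using (Σ; ∃; ∃-syntax; _×_; _,_; proj₁; proj₂)
open import Data.Sum using (_⊎_)
open import Relation.Binary.PropositionalEquality using (_≡_; _≢_)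
open import Relation.Binary.Construct.Closure.ReflexiveTransitive using (Star)
open import Relation.Nullary.Decidable using (⌊_⌋)
open import Function using (_∘_)
import Data.Vec
import Data.Bool.Properties

record Graph : Set where
  constructor mkGraph
  field
    n     : ℕ
    edges : List (Fin n × Fin n)

  m : ℕ
  m = length edges

  edge : Fin m → Fin n × Fin n
  edge = lookup edges

open Graph public

Adjacent : {N : ℕ} → List (Fin N × Fin N) → Fin N → Fin N → Set
Adjacent es u v = ((u , v) ∈ es) ⊎ ((v , u) ∈ es)

Connected : {N : ℕ} → List (Fin N × Fin N) → Set
Connected {N} es = (u v : Fin N) → Star (Adjacent es) u v

-- Combinatorial maps (rotation systems).  Darts of edge i are (i , false)
-- (at its first endpoint) and (i , true) (at its second endpoint).

Dart : ℕ → Set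
Dart M = Fin M × Bool

iter : {A : Set} → ℕ → (A → A) → A → A
iter zero    f x = x
iter (suc k) f x = f (iter k f x)

module _ {N : ℕ} (es : List (Fin N × Fin N)) where

  dartVertex : Dart (length es) → Fin N
  dartVertex (i , false) = proj₁ (lookup es i)
  dartVertex (i , true)  = proj₂ (lookup es i)

  flipDart : Dart (length es) → Dart (length es)
  flipDart (i , b) = (i , not b)

  -- A rotation system σ: a permutation of the darts that fixes the vertex
  -- of each dart and acts as a single cycle on the darts at each vertex;
  -- its face permutation is φ = σ ∘ α, and F is the number of faces
  -- (orbits of φ), witnessed by a face labelling that is constant exactly
  -- on φ-orbits and hits every label.
  record RotationSystem (F : ℕ) : Set where
    field
      σ        : Dart (length es) → Dart (length es)
      σ⁻¹      : Dart (length es) → Dart (length es)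
      σ-inv₁   : ∀ d → σ (σ⁻¹ d) ≡ d
      σ-inv₂   : ∀ d → σ⁻¹ (σ d) ≡ d
      σ-vertex : ∀ d → dartVertex (σ d) ≡ dartVertex d
      σ-cyclic : ∀ d d' → dartVertex d ≡ dartVertex d' → ∃[ k ] iter k σ d ≡ d'
      face         : Dart (length es) → Fin F
      face-φ       : ∀ d → face (σ (flipDart d)) ≡ face d
      face-orbit   : ∀ d d' → face d ≡ face d' → ∃[ k ] iter k (σ ∘ flipDart) d ≡ d'
      face-onto    : ∀ (f : Fin F) → ∃[ d ] face d ≡ f

  -- A connected graph with a genus-0 combinatorial embedding:
  -- V − E + F = 2.
  SphericalMap : Set
  SphericalMap = Connected es × ∃[ F ] (RotationSystem F × (N + F ≡ length es + 2))

-- Planarity: G is planar iff it is a subgraph of a connected graph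
-- (obtained by adding j new vertices and some extra edges) that admits a
-- spherical combinatorial map.

liftEdge : {n : ℕ} (j : ℕ) → Fin n × Fin n → Fin (n + j) × Fin (n + j)
liftEdge j (u , v) = (u ↑ˡ j , v ↑ˡ j)

Planar : Graph → Set
Planar (mkGraph n es) =
  ∃[ j ] ∃[ extra ] SphericalMap {n + j} (map (liftEdge j) es ++ extra)

-- Modified planar graph: planar graph plus two (distinct) new vertices a, b
-- and arbitrarily many edges incident to a or b.  Equivalently: deleting all
-- edges incident to a or b leaves a planar graph (a, b become isolated).

_==ᶠ_ : {n : ℕ} → Fin n → Fin n → Bool
u ==ᶠ v = ⌊ u ≟ᶠ v ⌋

avoids : {n : ℕ} → Fin n → Fin n → Fin n × Fin n → Bool
avoids a b (u , v) = not (u ==ᶠ a ∨ u ==ᶠ b ∨ v ==ᶠ a ∨ v ==ᶠ b)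

ModifiedPlanar : Graph → Set
ModifiedPlanar (mkGraph n es) =
  Σ (Fin n) λ a → Σ (Fin n) λ b → a ≢ b × Planar (mkGraph n (filterᵇ (avoids a b) es))

-- Regions (edge-induced subgraphs) of G are subsets of E(G).

anyFin : {k : ℕ} → (Fin k → Bool) → Bool
anyFin {zero}  f = false
anyFin {suc k} f = f Fin.zero ∨ anyFin (f ∘ Fin.suc)

module _ (G : Graph) where

  Region : Set
  Region = Subset (m G)

  V : Region → Subset (n G)
  V H = tabulate λ v → anyFin λ i →
          Data.Vec.lookup H i ∧ (v ==ᶠ proj₁ (edge G i) ∨ v ==ᶠ proj₂ (edge G i))

  data Tree : Set where
    leaf : (H : Region) (∂ : Subset (n G)) → Tree
    node : (H : Region) (∂ S : Subset (n G)) (D₁ D₂ : Tree) → Tree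

  region : Tree → Region
  region (leaf H ∂)         = H
  region (node H ∂ S D₁ D₂) = H

  boundary : Tree → Subset (n G)
  boundary (leaf H ∂)         = ∂
  boundary (node H ∂ S D₁ D₂) = ∂

  eliminated : Tree → Subset (n G)
  eliminated (leaf H ∂)         = V H ─ ∂
  eliminated (node H ∂ S D₁ D₂) = S ─ ∂

  -- Validity of a separator tree with separability parameters
  --   c (separator size  |S(H)| ≤ c ⌈|E(H)|^{1/2}⌉ ),
  --   b = p / q (balance |E(D_i)| ≤ b |E(H)|),
  --   L (leaves have at most L edges),
  -- given the boundary ∂ the node must have (determined by its parent).
  ValidTree : (c p q L : ℕ) → Subset (n G) → Tree → Set
  ValidTree c p q L ∂₀ (leaf H ∂) = (∂ ≡ ∂₀) × (∣ H ∣ ≤ L)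
  ValidTree c p q L ∂₀ (node H ∂ S D₁ D₂) =
      (∂ ≡ ∂₀)
    × (region D₁ ∪ region D₂ ≡ H)
    × (region D₁ ∩ region D₂ ≡ ⊥)
    × (V (region D₁) ∩ V (region D₂) ≡ S)
    -- |S| ≤ c · ⌈√|E(H)|⌉ , i.e. |S| ≤ c · s for every s with |E(H)| ≤ s²
    × (∀ s → ∣ H ∣ ≤ s * s → ∣ S ∣ ≤ c * s)
    × (q * ∣ region D₁ ∣ ≤ p * ∣ H ∣)
    × (q * ∣ region D₂ ∣ ≤ p * ∣ H ∣)
    × ValidTree c p q L ((∂ ∪ S) ∩ V (region D₁)) D₁
    × ValidTree c p q L ((∂ ∪ S) ∩ V (region D₂)) D₂

  IsSeparatorTree : (c p q L : ℕ) → Tree → Set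
  IsSeparatorTree c p q L T = (region T ≡ ⊤) × ValidTree c p q L ⊥ T

  -- Nodes of a tree are addressed by paths from the root
  -- (false = first child D₁, true = second child D₂).

  data IsNode : Tree → List Bool → Set where
    here  : ∀ {T} → IsNode T []
    left  : ∀ {H ∂ S D₁ D₂ p} → IsNode D₁ p → IsNode (node H ∂ S D₁ D₂) (false ∷ p)
    right : ∀ {H ∂ S D₁ D₂ p} → IsNode D₂ p → IsNode (node H ∂ S D₁ D₂) (true ∷ p)

  childPaths : Bool → List (List Bool) → List (List Bool)
  childPaths b []             = []
  childPaths b ([] ∷ ps)      = childPaths b ps
  childPaths b ((b' ∷ p) ∷ ps) =
    if ⌊ Data.Bool.Properties._≟_ b b' ⌋ then p ∷ childPaths b ps else childPaths b ps

  cost : Tree → ℕ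
  cost T = ∣ boundary T ∣ + ∣ eliminated T ∣

  -- Σ_{H ∈ P_T(𝓗)} (|∂H| + |F_H|), where 𝓗 is given by a list of node
  -- addresses relative to T: the current node lies on a path from some
  -- H ∈ 𝓗 to the root iff the list is nonempty.
  pathCost : Tree → List (List Bool) → ℕ
  pathCost T [] = 0
  pathCost (leaf H ∂) (p ∷ ps) = cost (leaf H ∂)
  pathCost (node H ∂ S D₁ D₂) (p ∷ ps) =
      cost (node H ∂ S D₁ D₂)
    + pathCost D₁ (childPaths false (p ∷ ps))
    + pathCost D₂ (childPaths true (p ∷ ps))

{-# OPTIONS --safe #-}
-- A node's boundary lies in the separators of its ancestors and its eliminated vertices lie in its
-- own separator (at a leaf, in V(H)).  So if X is the total size of the separators and leaf vertex
-- sets of the visited nodes, and visited nodes with nonempty regions have depth at most d, the cost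
-- is at most (2d+1)·X.  The visited regions on one level are disjoint and at most K many, and
-- |S(H)|² ≤ 4c²|E(H)|, so by Cauchy–Schwarz each level contributes at most √(κ·K·m) with
-- κ = 4(c² + L), whence X² ≤ κ(d+1)²·K·m.  Both bounds are proved together by induction on the
-- tree, the depth being controlled by the budget p^d·|E(H)| < q^d, which a balanced split passes
-- on to the children with d decreased by one; since (1 + 1/p)^p ≥ 2, d = p(⌈log₂ m⌉ + 1) is a
-- valid budget at the root.
module Submission where

open import Data.Bool using (Bool; true; false; _∧_; _∨_)
open import Data.Fin using (Fin; zero; suc)
open import Data.Fin.Properties using () renaming (_≟_ to _≟ᶠ_)
open import Data.Fin.Subset using (Subset; ⊥; ⁅_⁆; _∩_; _∪_; _─_; _⊆_; ∣_∣)
open import Data.Fin.Subset.Properties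
  using (∣⊥∣≡0; ∣⊤∣≡n; ∣⁅x⁆∣≡1; ∣p─q∣≤∣p∣; ∣p∩q∣≤∣p∣; ∣p∩q∣≤∣q∣; p⊆q⇒∣p∣≤∣q∣;
         p∩q⊆p; p∩q⊆q; x∈p∪q⁻; x∈p∩q⁻; x∈p∩q⁺)
open import Data.List using (List; []; _∷_; length)
open import Data.List.Relation.Unary.All using (All)
open import Data.List.Relation.Unary.Unique.Propositional using (Unique)
open import Data.Nat
open import Data.Nat.Induction using (<-wellFounded)
open import Data.Nat.Logarithm using (⌈log₂_⌉)
open import Data.Nat.Logarithm.Core using (⌈log2⌉)
open import Data.Nat.Properties
open import Data.Nat.Tactic.RingSolver using (solve-∀)
open import Data.Product using (∃-syntax; _×_; _,_; proj₁; proj₂)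
open import Data.Sum using ([_,_]′)
open import Data.Vec using (Vec; []; _∷_; tabulate; lookup)
open import Data.Vec.Properties using (tabulate-cong)
open import Induction.WellFounded using (Acc; acc)
open import Relation.Binary.PropositionalEquality
open import Relation.Nullary using (yes; no; contradiction)
open import Defs
open import Algebra.Properties.CommutativeSemigroup *-commutativeSemigroup using (x∙yz≈y∙xz; xy∙z≈xz∙y)

am-gm : ∀ m n → 4 * (m * n) ≤ (m + n) * (m + n)
am-gm m n = [ ordered , swapped ]′ (≤-total m n)
  where
  ordered : ∀ {m n} → m ≤ n → 4 * (m * n) ≤ (m + n) * (m + n)
  ordered {m} m≤n with m≤n⇒∃[o]m+o≡n m≤n
  ... | t , refl = ≤-trans (m≤m+n _ (t * t)) (≤-reflexive (square m t))
    where
    square : ∀ m t → 4 * (m * (m + t)) + t * t ≡ (m + (m + t)) * (m + (m + t))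
    square = solve-∀
  swapped : n ≤ m → 4 * (m * n) ≤ (m + n) * (m + n)
  swapped n≤m = subst₂ _≤_ (cong (4 *_) (*-comm n m)) (cong (λ s → s * s) (+-comm n m)) (ordered n≤m)

m*m≤n*n⇒m≤n : ∀ {m n} → m * m ≤ n * n → m ≤ n
m*m≤n*n⇒m≤n {m} {n} mm≤nn with m ≤? n
... | yes m≤n = m≤n
... | no m≰n = contradiction mm≤nn (<⇒≱ (*-mono-< (≰⇒> m≰n) (≰⇒> m≰n)))

cauchy-schwarz : ∀ M k₁ k₂ e₁ e₂ {x y} → x * x ≤ M * (k₁ * e₁) → y * y ≤ M * (k₂ * e₂) →
                 (x + y) * (x + y) ≤ M * ((k₁ + k₂) * (e₁ + e₂))
cauchy-schwarz M k₁ k₂ e₁ e₂ {x} {y} x² y² = begin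
  (x + y) * (x + y)                  ≡⟨ expand x y ⟩
  x * x + y * y + 2 * (x * y)        ≤⟨ +-mono-≤ (+-mono-≤ x² y²) cross ⟩
  M * (k₁ * e₁) + M * (k₂ * e₂) + (a + b) ≡⟨ collect M k₁ k₂ e₁ e₂ ⟩
  M * ((k₁ + k₂) * (e₁ + e₂))        ∎
  where
  open ≤-Reasoning
  a = M * (k₁ * e₂)
  b = M * (k₂ * e₁)
  expand : ∀ x y → (x + y) * (x + y) ≡ x * x + y * y + 2 * (x * y)
  expand = solve-∀
  collect : ∀ M k₁ k₂ e₁ e₂ →
    M * (k₁ * e₁) + M * (k₂ * e₂) + (M * (k₁ * e₂) + M * (k₂ * e₁)) ≡ M * ((k₁ + k₂) * (e₁ + e₂))
  collect = solve-∀
  regroup : ∀ x y → 2 * (x * y) * (2 * (x * y)) ≡ 4 * ((x * x) * (y * y))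
  regroup = solve-∀
  exchange : ∀ M k₁ k₂ e₁ e₂ → M * (k₁ * e₁) * (M * (k₂ * e₂)) ≡ M * (k₁ * e₂) * (M * (k₂ * e₁))
  exchange = solve-∀
  cross : 2 * (x * y) ≤ a + b
  cross = m*m≤n*n⇒m≤n (begin
    2 * (x * y) * (2 * (x * y))           ≡⟨ regroup x y ⟩
    4 * ((x * x) * (y * y))               ≤⟨ *-monoʳ-≤ 4 (*-mono-≤ x² y²) ⟩
    4 * (M * (k₁ * e₁) * (M * (k₂ * e₂))) ≡⟨ cong (4 *_) (exchange M k₁ k₂ e₁ e₂) ⟩
    4 * (a * b)                           ≤⟨ am-gm a b ⟩
    (a + b) * (a + b)                     ∎)

[1+s]²≤4[1+s²] : ∀ s → suc s * suc s ≤ 4 * suc (s * s)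
[1+s]²≤4[1+s²] zero    = s≤s z≤n
[1+s]²≤4[1+s²] (suc r) = ≤-trans (m≤m+n _ _) (≤-reflexive (excess r))
  where
  excess : ∀ r → suc (suc r) * suc (suc r) + (3 * (r * r) + 4 * r + 4) ≡ 4 * suc (suc r * suc r)
  excess = solve-∀

∃-square-between : ∀ e → ∃[ s ] e ≤ s * s × s * s ≤ 4 * e
∃-square-between zero = 0 , z≤n , z≤n
∃-square-between (suc e) with ∃-square-between e
... | s , e≤s² , s²≤4e with suc e ≤? s * s
...   | yes 1+e≤s² = s , 1+e≤s² , ≤-trans s²≤4e (*-monoʳ-≤ 4 (n≤1+n e))
...   | no 1+e≰s² = suc s , subst (λ t → suc t ≤ suc s * suc s) s²≡e (*-mono-< (n<1+n s) (n<1+n s)) ,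
                      subst (λ t → suc s * suc s ≤ 4 * suc t) s²≡e ([1+s]²≤4[1+s²] s)
  where
  s²≡e : s * s ≡ e
  s²≡e = ≤-antisym (≤-pred (≰⇒> 1+e≰s²)) e≤s²

n≤2^⌈log2⌉n : ∀ n (rec : Acc _<_ n) → n ≤ 2 ^ ⌈log2⌉ n rec
n≤2^⌈log2⌉n 0 _ = z≤n
n≤2^⌈log2⌉n 1 _ = ≤-refl
n≤2^⌈log2⌉n (suc (suc n)) (acc rs) = begin
  suc (suc n)                         ≡⟨ ⌊n/2⌋+⌈n/2⌉≡n (suc (suc n)) ⟨
  ⌊ suc (suc n) /2⌋ + h               ≤⟨ +-monoˡ-≤ h (⌊n/2⌋≤⌈n/2⌉ (suc (suc n))) ⟩
  h + h                               ≤⟨ +-mono-≤ ih ih ⟩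
  2 ^ L + 2 ^ L                       ≡⟨ cong (2 ^ L +_) (+-identityʳ (2 ^ L)) ⟨
  2 ^ suc L                           ∎
  where
  open ≤-Reasoning
  h = ⌈ suc (suc n) /2⌉
  L = ⌈log2⌉ h (rs (⌈n/2⌉<n n))
  ih : h ≤ 2 ^ L
  ih = n≤2^⌈log2⌉n h (rs (⌈n/2⌉<n n))

n≤2^⌈log₂n⌉ : ∀ n → n ≤ 2 ^ ⌈log₂ n ⌉
n≤2^⌈log₂n⌉ n = n≤2^⌈log2⌉n n (<-wellFounded n)

bernoulli : ∀ a n → a ^ n * (a + n) ≤ suc a ^ n * a
bernoulli a zero    = ≤-reflexive (cong (λ x → 1 * x) (+-identityʳ a))
bernoulli a (suc n) = begin
  a * a ^ n * (a + suc n)              ≤⟨ m≤m+n _ (a ^ n * n) ⟩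
  a * a ^ n * (a + suc n) + a ^ n * n  ≡⟨ regroup a n (a ^ n) ⟩
  suc a * (a ^ n * (a + n))            ≤⟨ *-monoʳ-≤ (suc a) (bernoulli a n) ⟩
  suc a * (suc a ^ n * a)              ≡⟨ *-assoc (suc a) (suc a ^ n) a ⟨
  suc a ^ suc n * a                    ∎
  where
  open ≤-Reasoning
  regroup : ∀ a n aⁿ → a * aⁿ * (a + suc n) + aⁿ * n ≡ suc a * (aⁿ * (a + n))
  regroup = solve-∀

2*p^p≤[1+p]^p : ∀ p .{{_ : NonZero p}} → 2 * p ^ p ≤ suc p ^ p
2*p^p≤[1+p]^p p@(suc _) = *-cancelʳ-≤ (2 * p ^ p) (suc p ^ p) p (begin
  2 * p ^ p * p      ≡⟨ double (p ^ p) p ⟩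
  p ^ p * (p + p)    ≤⟨ bernoulli p p ⟩
  suc p ^ p * p      ∎)
  where
  open ≤-Reasoning
  double : ∀ x p → 2 * x * p ≡ x * (p + p)
  double = solve-∀

a^t*2^t≤b^t : ∀ {a b} → 2 * a ≤ b → ∀ t → a ^ t * 2 ^ t ≤ b ^ t
a^t*2^t≤b^t 2a≤b zero    = ≤-refl
a^t*2^t≤b^t {a} {b} 2a≤b (suc t) = begin
  a * a ^ t * (2 * 2 ^ t)     ≡⟨ [m*n]*[o*p]≡[m*o]*[n*p] a (a ^ t) 2 (2 ^ t) ⟩
  a * 2 * (a ^ t * 2 ^ t)     ≤⟨ *-mono-≤ (≤-trans (≤-reflexive (*-comm a 2)) 2a≤b) (a^t*2^t≤b^t 2a≤b t) ⟩
  b * b ^ t                   ∎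
  where open ≤-Reasoning

depth-budget : ∀ p q m → 0 < p → p < q → p ^ (p * suc ⌈log₂ m ⌉) * m < q ^ (p * suc ⌈log₂ m ⌉)
depth-budget p@(suc _) q m _ p<q = begin-strict
  p ^ (p * t) * m          <⟨ *-monoʳ-< (p ^ (p * t)) {{m^n≢0 p (p * t)}} m<2^t ⟩
  p ^ (p * t) * 2 ^ t      ≡⟨ cong (_* 2 ^ t) (^-*-assoc p p t) ⟨
  (p ^ p) ^ t * 2 ^ t      ≤⟨ a^t*2^t≤b^t {p ^ p} {q ^ p} (≤-trans (2*p^p≤[1+p]^p p) (^-monoˡ-≤ p p<q)) t ⟩
  (q ^ p) ^ t              ≡⟨ ^-*-assoc q p t ⟩
  q ^ (p * t)              ∎
  where
  open ≤-Reasoning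
  t = suc ⌈log₂ m ⌉
  m<2^t : m < 2 ^ t
  m<2^t = ≤-<-trans (n≤2^⌈log₂n⌉ m) (^-monoʳ-< 2 (s≤s (s≤s z≤n)) (n<1+n ⌈log₂ m ⌉))

∣p∪q∣+∣p∩q∣≡∣p∣+∣q∣ : ∀ {n} (p q : Subset n) → ∣ p ∪ q ∣ + ∣ p ∩ q ∣ ≡ ∣ p ∣ + ∣ q ∣
∣p∪q∣+∣p∩q∣≡∣p∣+∣q∣ []          []          = refl
∣p∪q∣+∣p∩q∣≡∣p∣+∣q∣ (false ∷ p) (false ∷ q) = ∣p∪q∣+∣p∩q∣≡∣p∣+∣q∣ p q
∣p∪q∣+∣p∩q∣≡∣p∣+∣q∣ (false ∷ p) (true ∷ q)  = trans (cong suc (∣p∪q∣+∣p∩q∣≡∣p∣+∣q∣ p q)) (sym (+-suc _ _))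
∣p∪q∣+∣p∩q∣≡∣p∣+∣q∣ (true ∷ p)  (false ∷ q) = cong suc (∣p∪q∣+∣p∩q∣≡∣p∣+∣q∣ p q)
∣p∪q∣+∣p∩q∣≡∣p∣+∣q∣ (true ∷ p)  (true ∷ q)  =
  cong suc (trans (+-suc _ _) (trans (cong suc (∣p∪q∣+∣p∩q∣≡∣p∣+∣q∣ p q)) (sym (+-suc _ _))))

∣p∪q∣≤∣p∣+∣q∣ : ∀ {n} (p q : Subset n) → ∣ p ∪ q ∣ ≤ ∣ p ∣ + ∣ q ∣
∣p∪q∣≤∣p∣+∣q∣ p q = subst (∣ p ∪ q ∣ ≤_) (∣p∪q∣+∣p∩q∣≡∣p∣+∣q∣ p q) (m≤m+n _ _)

p∩q≡⊥⇒∣p∣+∣q∣≡∣p∪q∣ : ∀ {n} (p q : Subset n) → p ∩ q ≡ ⊥ → ∣ p ∣ + ∣ q ∣ ≡ ∣ p ∪ q ∣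
p∩q≡⊥⇒∣p∣+∣q∣≡∣p∪q∣ {n} p q p∩q≡⊥ = begin
  ∣ p ∣ + ∣ q ∣             ≡⟨ ∣p∪q∣+∣p∩q∣≡∣p∣+∣q∣ p q ⟨
  ∣ p ∪ q ∣ + ∣ p ∩ q ∣     ≡⟨ cong (λ r → ∣ p ∪ q ∣ + ∣ r ∣) p∩q≡⊥ ⟩
  ∣ p ∪ q ∣ + ∣ ⊥ {n} ∣     ≡⟨ cong (∣ p ∪ q ∣ +_) (∣⊥∣≡0 n) ⟩
  ∣ p ∪ q ∣ + 0             ≡⟨ +-identityʳ _ ⟩
  ∣ p ∪ q ∣                 ∎
  where open ≡-Reasoning

∣x∩p∣+∣x∩q∣≤∣x∣+∣p∩q∣ : ∀ {n} (x p q : Subset n) → ∣ x ∩ p ∣ + ∣ x ∩ q ∣ ≤ ∣ x ∣ + ∣ p ∩ q ∣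
∣x∩p∣+∣x∩q∣≤∣x∣+∣p∩q∣ x p q = begin
  ∣ x ∩ p ∣ + ∣ x ∩ q ∣                                 ≡⟨ ∣p∪q∣+∣p∩q∣≡∣p∣+∣q∣ (x ∩ p) (x ∩ q) ⟨
  ∣ (x ∩ p) ∪ (x ∩ q) ∣ + ∣ (x ∩ p) ∩ (x ∩ q) ∣         ≤⟨ +-mono-≤ (p⊆q⇒∣p∣≤∣q∣ union⊆x) (p⊆q⇒∣p∣≤∣q∣ meet⊆p∩q) ⟩
  ∣ x ∣ + ∣ p ∩ q ∣                                     ∎
  where
  open ≤-Reasoning
  union⊆x : (x ∩ p) ∪ (x ∩ q) ⊆ x
  union⊆x i∈ = [ p∩q⊆p x p , p∩q⊆p x q ]′ (x∈p∪q⁻ (x ∩ p) (x ∩ q) i∈)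
  meet⊆p∩q : (x ∩ p) ∩ (x ∩ q) ⊆ p ∩ q
  meet⊆p∩q i∈ with x∈p∩q⁻ (x ∩ p) (x ∩ q) i∈
  ... | i∈x∩p , i∈x∩q = x∈p∩q⁺ (p∩q⊆q x p i∈x∩p , p∩q⊆q x q i∈x∩q)

tabulate-false : ∀ {n} → tabulate {n = n} (λ _ → false) ≡ ⊥
tabulate-false {zero}  = refl
tabulate-false {suc n} = cong (false ∷_) tabulate-false

suc-==ᶠ-suc : ∀ {n} (v u : Fin n) → (suc v ==ᶠ suc u) ≡ (v ==ᶠ u)
suc-==ᶠ-suc v u with v ≟ᶠ u
... | yes _ = refl
... | no  _ = refl

tabulate-==ᶠ : ∀ {n} (u : Fin n) → tabulate (_==ᶠ u) ≡ ⁅ u ⁆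
tabulate-==ᶠ zero    = cong (true ∷_) tabulate-false
tabulate-==ᶠ (suc u) = cong (false ∷_) (trans (tabulate-cong (λ v → suc-==ᶠ-suc v u)) (tabulate-==ᶠ u))

tabulate-∨ : ∀ {n} (f g : Fin n → Bool) → tabulate (λ i → f i ∨ g i) ≡ tabulate f ∪ tabulate g
tabulate-∨ {zero}  f g = refl
tabulate-∨ {suc n} f g = cong ((f zero ∨ g zero) ∷_) (tabulate-∨ (λ i → f (suc i)) (λ i → g (suc i)))

endpoints : ∀ {n k} → Vec Bool k → (Fin k → Fin n × Fin n) → Subset n
endpoints H e = tabulate λ v → anyFin λ i → lookup H i ∧ (v ==ᶠ proj₁ (e i) ∨ v ==ᶠ proj₂ (e i))

∣endpoints∣≤2∣H∣ : ∀ {n k} (H : Vec Bool k) (e : Fin k → Fin n × Fin n) → ∣ endpoints H e ∣ ≤ 2 * ∣ H ∣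
∣endpoints∣≤2∣H∣ {n} []          e = ≤-reflexive (trans (cong ∣_∣ (tabulate-false {n})) (∣⊥∣≡0 n))
∣endpoints∣≤2∣H∣     (false ∷ H) e = ∣endpoints∣≤2∣H∣ H (λ i → e (suc i))
∣endpoints∣≤2∣H∣     (true ∷ H)  e = begin
  ∣ endpoints (true ∷ H) e ∣                 ≡⟨ cong ∣_∣ (tabulate-∨ (λ v → v ==ᶠ u ∨ v ==ᶠ w) _) ⟩
  ∣ tabulate (λ v → v ==ᶠ u ∨ v ==ᶠ w) ∪ rest ∣ ≡⟨ cong (λ s → ∣ s ∪ rest ∣) (tabulate-∨ (_==ᶠ u) (_==ᶠ w)) ⟩
  ∣ (tabulate (_==ᶠ u) ∪ tabulate (_==ᶠ w)) ∪ rest ∣ ≡⟨ cong₂ (λ s t → ∣ (s ∪ t) ∪ rest ∣) (tabulate-==ᶠ u) (tabulate-==ᶠ w) ⟩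
  ∣ (⁅ u ⁆ ∪ ⁅ w ⁆) ∪ rest ∣                 ≤⟨ ∣p∪q∣≤∣p∣+∣q∣ (⁅ u ⁆ ∪ ⁅ w ⁆) rest ⟩
  ∣ ⁅ u ⁆ ∪ ⁅ w ⁆ ∣ + ∣ rest ∣               ≤⟨ +-mono-≤ (∣p∪q∣≤∣p∣+∣q∣ ⁅ u ⁆ ⁅ w ⁆) (∣endpoints∣≤2∣H∣ H (λ i → e (suc i))) ⟩
  ∣ ⁅ u ⁆ ∣ + ∣ ⁅ w ⁆ ∣ + 2 * ∣ H ∣          ≡⟨ cong₂ (λ a b → a + b + 2 * ∣ H ∣) (∣⁅x⁆∣≡1 u) (∣⁅x⁆∣≡1 w) ⟩
  2 + 2 * ∣ H ∣                              ≡⟨ *-suc 2 ∣ H ∣ ⟨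
  2 * suc ∣ H ∣                              ∎
  where
  open ≤-Reasoning
  u = proj₁ (e zero)
  w = proj₂ (e zero)
  rest = endpoints H (λ i → e (suc i))

∣V∣≤2∣H∣ : ∀ G (H : Region G) → ∣ V G H ∣ ≤ 2 * ∣ H ∣
∣V∣≤2∣H∣ G H = ∣endpoints∣≤2∣H∣ H (edge G)

∣V∣≤0 : ∀ G (H : Region G) → ∣ H ∣ ≡ 0 → ∣ V G H ∣ ≤ 0
∣V∣≤0 G H ∣H∣≡0 = subst (λ e → ∣ V G H ∣ ≤ 2 * e) ∣H∣≡0 (∣V∣≤2∣H∣ G H)

childPaths-length : ∀ G ps → length (childPaths G false ps) + length (childPaths G true ps) ≤ length ps
childPaths-length G []                 = z≤n
childPaths-length G ([] ∷ ps)          = m≤n⇒m≤1+n (childPaths-length G ps)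
childPaths-length G ((false ∷ _) ∷ ps) = s≤s (childPaths-length G ps)
childPaths-length G ((true ∷ _) ∷ ps)  =
  subst (_≤ suc (length ps)) (sym (+-suc _ _)) (s≤s (childPaths-length G ps))

budget-child : ∀ p q d e e₁ → q * e₁ ≤ p * e → p ^ suc d * e < q ^ suc d → p ^ d * e₁ < q ^ d
budget-child p q d e e₁ q*e₁≤p*e budget = *-cancelˡ-< q (p ^ d * e₁) (q ^ d) (begin-strict
  q * (p ^ d * e₁)   ≡⟨ x∙yz≈y∙xz q (p ^ d) e₁ ⟩
  p ^ d * (q * e₁)   ≤⟨ *-monoʳ-≤ (p ^ d) q*e₁≤p*e ⟩
  p ^ d * (p * e)    ≡⟨ x∙yz≈y∙xz (p ^ d) p e ⟩
  p * (p ^ d * e)    ≡⟨ *-assoc p (p ^ d) e ⟨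
  p ^ suc d * e      <⟨ budget ⟩
  q ^ suc d          ∎)
  where open ≤-Reasoning

cost-step : ∀ d B σ f b₁ b₂ X₁ X₂ P₁ P₂ → f ≤ σ → b₁ + b₂ ≤ B + σ + σ →
  P₁ ≤ suc d * b₁ + suc (2 * d) * X₁ → P₂ ≤ suc d * b₂ + suc (2 * d) * X₂ →
  B + f + P₁ + P₂ ≤ suc (suc d) * B + suc (2 * suc d) * (σ + (X₁ + X₂))
cost-step d B σ f b₁ b₂ X₁ X₂ P₁ P₂ f≤σ b≤ P₁≤ P₂≤ = begin
  B + f + P₁ + P₂                                          ≤⟨ +-mono-≤ (+-mono-≤ (+-monoʳ-≤ B f≤σ) P₁≤) P₂≤ ⟩
  B + σ + (suc d * b₁ + a * X₁) + (suc d * b₂ + a * X₂)    ≡⟨ collect d B σ b₁ b₂ X₁ X₂ ⟩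
  B + σ + suc d * (b₁ + b₂) + a * (X₁ + X₂)                ≤⟨ +-monoˡ-≤ _ (+-monoʳ-≤ (B + σ) (*-monoʳ-≤ (suc d) b≤)) ⟩
  B + σ + suc d * (B + σ + σ) + a * (X₁ + X₂)              ≤⟨ m≤m+n _ (2 * (X₁ + X₂)) ⟩
  B + σ + suc d * (B + σ + σ) + a * (X₁ + X₂) + 2 * (X₁ + X₂) ≡⟨ regroup d B σ X₁ X₂ ⟩
  suc (suc d) * B + suc (2 * suc d) * (σ + (X₁ + X₂))     ∎
  where
  open ≤-Reasoning
  a = suc (2 * d)
  collect : ∀ d B σ b₁ b₂ X₁ X₂ →
    B + σ + (suc d * b₁ + suc (2 * d) * X₁) + (suc d * b₂ + suc (2 * d) * X₂)
      ≡ B + σ + suc d * (b₁ + b₂) + suc (2 * d) * (X₁ + X₂)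
  collect = solve-∀
  regroup : ∀ d B σ X₁ X₂ →
    B + σ + suc d * (B + σ + σ) + suc (2 * d) * (X₁ + X₂) + 2 * (X₁ + X₂)
      ≡ suc (suc d) * B + suc (2 * suc d) * (σ + (X₁ + X₂))
  regroup = solve-∀

-- Cauchy–Schwarz twice: over the two subtrees, then with weights 1 : d+1 for S(H) against the
-- d+1 levels below it.
mass-step : ∀ κ d k e σ X₁ X₂ k₁ k₂ e₁ e₂ → k₁ + k₂ ≤ suc k → e₁ + e₂ ≤ e → σ * σ ≤ κ * e →
  X₁ * X₁ ≤ κ * (suc d * suc d) * (k₁ * e₁) → X₂ * X₂ ≤ κ * (suc d * suc d) * (k₂ * e₂) →
  (σ + (X₁ + X₂)) * (σ + (X₁ + X₂)) ≤ κ * (suc (suc d) * suc (suc d)) * (suc k * e)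
mass-step κ d k e σ X₁ X₂ k₁ k₂ e₁ e₂ k≤ e≤ σ² X₁² X₂² =
  subst ((σ + (X₁ + X₂)) * (σ + (X₁ + X₂)) ≤_) (reweigh κ d k e)
        (cauchy-schwarz (κ * (suc k * e)) 1 (suc d) 1 (suc d) {σ} σ²′ X²)
  where
  κᵈ = κ * (suc d * suc d)
  σ²′ : σ * σ ≤ κ * (suc k * e) * (1 * 1)
  σ²′ = ≤-trans σ² (≤-trans (*-monoʳ-≤ κ (m≤m+n e (k * e))) (≤-reflexive (sym (*-identityʳ _))))
  X² : (X₁ + X₂) * (X₁ + X₂) ≤ κ * (suc k * e) * (suc d * suc d)
  X² = begin
    (X₁ + X₂) * (X₁ + X₂)           ≤⟨ cauchy-schwarz κᵈ k₁ k₂ e₁ e₂ {X₁} X₁² X₂² ⟩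
    κᵈ * ((k₁ + k₂) * (e₁ + e₂))    ≤⟨ *-monoʳ-≤ κᵈ (*-mono-≤ k≤ e≤) ⟩
    κᵈ * (suc k * e)                ≡⟨ xy∙z≈xz∙y κ (suc d * suc d) (suc k * e) ⟩
    κ * (suc k * e) * (suc d * suc d) ∎
    where open ≤-Reasoning
  reweigh : ∀ κ d k e →
    κ * (suc k * e) * ((1 + suc d) * (1 + suc d)) ≡ κ * (suc (suc d) * suc (suc d)) * (suc k * e)
  reweigh = solve-∀

-- κ bounds |S(H)|²/|E(H)| at internal nodes, where |S(H)| ≤ c⌈√|E(H)|⌉, and |V(H)|²/|E(H)| at
-- leaves, where |V(H)| ≤ 2|E(H)| ≤ 2L.
mass-constant : ℕ → ℕ → ℕ
mass-constant c L = 4 * (c * c + L)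

separator²≤κe : ∀ c L e σ → (∀ s → e ≤ s * s → σ ≤ c * s) → σ * σ ≤ mass-constant c L * e
separator²≤κe c L e σ σ≤c*s with ∃-square-between e
... | s , e≤s² , s²≤4e = begin
  σ * σ               ≤⟨ *-mono-≤ (σ≤c*s s e≤s²) (σ≤c*s s e≤s²) ⟩
  c * s * (c * s)     ≡⟨ [m*n]*[o*p]≡[m*o]*[n*p] c s c s ⟩
  c * c * (s * s)     ≤⟨ *-monoʳ-≤ (c * c) s²≤4e ⟩
  c * c * (4 * e)     ≡⟨ x∙yz≈y∙xz (c * c) 4 e ⟩
  4 * (c * c * e)     ≤⟨ *-monoʳ-≤ 4 (*-monoˡ-≤ e (m≤m+n (c * c) L)) ⟩
  4 * ((c * c + L) * e) ≡⟨ *-assoc 4 (c * c + L) e ⟨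
  mass-constant c L * e ∎
  where open ≤-Reasoning

leaf²≤κe : ∀ c L e v → v ≤ 2 * e → e ≤ L → v * v ≤ mass-constant c L * e
leaf²≤κe c L e v v≤2e e≤L = begin
  v * v               ≤⟨ *-mono-≤ v≤2e v≤2e ⟩
  2 * e * (2 * e)     ≡⟨ [m*n]*[o*p]≡[m*o]*[n*p] 2 e 2 e ⟩
  4 * (e * e)         ≤⟨ *-monoʳ-≤ 4 (*-monoˡ-≤ e (≤-trans e≤L (m≤n+m L (c * c)))) ⟩
  4 * ((c * c + L) * e) ≡⟨ *-assoc 4 (c * c + L) e ⟨
  mass-constant c L * e ∎
  where open ≤-Reasoning

module _ (G : Graph) (c p q L : ℕ) where

  private
    κ = mass-constant c L

  -- Empty regions are balanced vacuously, so their subtrees escape the depth budget.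
  pathCost-empty : ∀ T ∂₀ ps → ValidTree G c p q L ∂₀ T → ∣ region G T ∣ ≡ 0 → pathCost G T ps ≤ ∣ ∂₀ ∣
  pathCost-empty T ∂₀ [] _ _ = z≤n
  pathCost-empty (leaf H ∂) ∂₀ (_ ∷ _) (refl , _) ∣H∣≡0 = begin
    ∣ ∂ ∣ + ∣ V G H ─ ∂ ∣   ≤⟨ +-monoʳ-≤ ∣ ∂ ∣ (≤-trans (∣p─q∣≤∣p∣ (V G H) ∂) (∣V∣≤0 G H ∣H∣≡0)) ⟩
    ∣ ∂ ∣ + 0               ≡⟨ +-identityʳ ∣ ∂ ∣ ⟩
    ∣ ∂ ∣                   ∎
    where open ≤-Reasoning
  pathCost-empty (node _ ∂ _ D₁ D₂) ∂₀ ps@(_ ∷ _)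
    (refl , refl , disjoint , refl , _ , _ , _ , valid₁ , valid₂) ∣H∣≡0 = begin
    ∣ ∂ ∣ + ∣ S ─ ∂ ∣ + P₁ + P₂  ≤⟨ +-mono-≤ (+-mono-≤ (+-monoʳ-≤ ∣ ∂ ∣ S─∂≤0) P₁≤0) P₂≤0 ⟩
    ∣ ∂ ∣ + 0 + 0 + 0           ≡⟨ trans (+-identityʳ _) (trans (+-identityʳ _) (+-identityʳ _)) ⟩
    ∣ ∂ ∣                       ∎
    where
    open ≤-Reasoning
    V₁ = V G (region G D₁)
    V₂ = V G (region G D₂)
    S = V₁ ∩ V₂
    P₁ = pathCost G D₁ (childPaths G false ps)
    P₂ = pathCost G D₂ (childPaths G true ps)
    e₁+e₂≡0 : ∣ region G D₁ ∣ + ∣ region G D₂ ∣ ≡ 0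
    e₁+e₂≡0 = trans (p∩q≡⊥⇒∣p∣+∣q∣≡∣p∪q∣ (region G D₁) (region G D₂) disjoint) ∣H∣≡0
    e₁≡0 = m+n≡0⇒m≡0 ∣ region G D₁ ∣ e₁+e₂≡0
    e₂≡0 = m+n≡0⇒n≡0 ∣ region G D₁ ∣ e₁+e₂≡0
    S─∂≤0 : ∣ S ─ ∂ ∣ ≤ 0
    S─∂≤0 = ≤-trans (∣p─q∣≤∣p∣ S ∂) (≤-trans (∣p∩q∣≤∣p∣ V₁ V₂) (∣V∣≤0 G (region G D₁) e₁≡0))
    P₁≤0 : P₁ ≤ 0
    P₁≤0 = ≤-trans (pathCost-empty D₁ _ (childPaths G false ps) valid₁ e₁≡0)
                   (≤-trans (∣p∩q∣≤∣q∣ (∂ ∪ S) V₁) (∣V∣≤0 G (region G D₁) e₁≡0))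
    P₂≤0 : P₂ ≤ 0
    P₂≤0 = ≤-trans (pathCost-empty D₂ _ (childPaths G true ps) valid₂ e₂≡0)
                   (≤-trans (∣p∩q∣≤∣q∣ (∂ ∪ S) V₂) (∣V∣≤0 G (region G D₂) e₂≡0))

  pathCost-bound : ∀ T d ∂₀ ps → ValidTree G c p q L ∂₀ T → p ^ d * ∣ region G T ∣ < q ^ d →
    ∃[ X ] pathCost G T ps ≤ suc d * ∣ ∂₀ ∣ + suc (2 * d) * X
         × X * X ≤ κ * (suc d * suc d) * (length ps * ∣ region G T ∣)
  pathCost-bound T d ∂₀ [] _ _ = 0 , z≤n , z≤n
  pathCost-bound (leaf H ∂) d ∂₀ (_ ∷ ps) (refl , ∣H∣≤L) _ =
    ∣ V G H ∣ ,
    +-mono-≤ (m≤n*m ∣ ∂ ∣ (suc d)) (≤-trans (∣p─q∣≤∣p∣ (V G H) ∂) (m≤n*m ∣ V G H ∣ (suc (2 * d)))) ,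
    ≤-trans (leaf²≤κe c L ∣ H ∣ ∣ V G H ∣ (∣V∣≤2∣H∣ G H) ∣H∣≤L)
            (*-mono-≤ (m≤m*n κ (suc d * suc d)) (m≤n*m ∣ H ∣ (suc (length ps))))
  pathCost-bound T@(node _ _ _ _ _) zero ∂₀ ps@(_ ∷ _) valid budget =
    0 , ≤-trans (pathCost-empty T ∂₀ ps valid ∣H∣≡0) (≤-trans (m≤n*m _ 1) (m≤m+n _ _)) , z≤n
    where
    ∣H∣≡0 : ∣ region G T ∣ ≡ 0
    ∣H∣≡0 = trans (sym (*-identityˡ _)) (n<1⇒n≡0 budget)
  pathCost-bound (node _ ∂ _ D₁ D₂) (suc d) ∂₀ ps@(_ ∷ ps′)
    (refl , refl , disjoint , refl , separator , balanced₁ , balanced₂ , valid₁ , valid₂) budget =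
    let (X₁ , cost₁ , mass₁) = pathCost-bound D₁ d ∂₁ ps₁ valid₁ (budget-child p q d e e₁ balanced₁ budget)
        (X₂ , cost₂ , mass₂) = pathCost-bound D₂ d ∂₂ ps₂ valid₂ (budget-child p q d e e₂ balanced₂ budget)
    in ∣ S ∣ + (X₁ + X₂) ,
       cost-step d (∣ ∂ ∣) (∣ S ∣) (∣ S ─ ∂ ∣) (∣ ∂₁ ∣) (∣ ∂₂ ∣) X₁ X₂ (pathCost G D₁ ps₁) (pathCost G D₂ ps₂)
         (∣p─q∣≤∣p∣ S ∂) boundaries cost₁ cost₂ ,
       mass-step κ d (length ps′) e (∣ S ∣) X₁ X₂ (length ps₁) (length ps₂) e₁ e₂ (childPaths-length G ps) e₁+e₂≤e
         (separator²≤κe c L e (∣ S ∣) separator) mass₁ mass₂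
    where
    V₁ = V G (region G D₁)
    V₂ = V G (region G D₂)
    S = V₁ ∩ V₂
    ∂₁ = (∂ ∪ S) ∩ V₁
    ∂₂ = (∂ ∪ S) ∩ V₂
    ps₁ = childPaths G false ps
    ps₂ = childPaths G true ps
    e₁ = ∣ region G D₁ ∣
    e₂ = ∣ region G D₂ ∣
    e = ∣ region G D₁ ∪ region G D₂ ∣
    e₁+e₂≤e : e₁ + e₂ ≤ e
    e₁+e₂≤e = ≤-reflexive (p∩q≡⊥⇒∣p∣+∣q∣≡∣p∪q∣ (region G D₁) (region G D₂) disjoint)
    boundaries : ∣ ∂₁ ∣ + ∣ ∂₂ ∣ ≤ ∣ ∂ ∣ + ∣ S ∣ + ∣ S ∣
    boundaries = ≤-trans (∣x∩p∣+∣x∩q∣≤∣x∣+∣p∩q∣ (∂ ∪ S) V₁ V₂) (+-monoˡ-≤ ∣ S ∣ (∣p∪q∣≤∣p∣+∣q∣ ∂ S))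

  pathCost²≤ : ∀ T d ps → ValidTree G c p q L ⊥ T → p ^ d * ∣ region G T ∣ < q ^ d →
    pathCost G T ps * pathCost G T ps ≤ 4 * κ * suc d ^ 4 * (length ps * ∣ region G T ∣)
  pathCost²≤ T d ps valid budget =
    let (X , cost , mass) = pathCost-bound T d ⊥ ps valid budget
        pc≤ : pathCost G T ps ≤ suc (2 * d) * X
        pc≤ = ≤-trans cost (≤-reflexive (cong (_+ suc (2 * d) * X)
                (trans (cong (suc d *_) (∣⊥∣≡0 (n G))) (*-zeroʳ (suc d)))))
    in begin
    pathCost G T ps * pathCost G T ps   ≤⟨ *-mono-≤ pc≤ pc≤ ⟩
    suc (2 * d) * X * (suc (2 * d) * X) ≡⟨ [m*n]*[o*p]≡[m*o]*[n*p] (suc (2 * d)) X (suc (2 * d)) X ⟩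
    suc (2 * d) * suc (2 * d) * (X * X) ≤⟨ *-mono-≤ (*-mono-≤ odd≤even odd≤even) mass ⟩
    2 * suc d * (2 * suc d) * (κ * (suc d * suc d) * (ps# * e)) ≡⟨ collect κ d ps# e ⟩
    4 * κ * suc d ^ 4 * (ps# * e)       ∎
    where
    open ≤-Reasoning
    ps# = length ps
    e = ∣ region G T ∣
    odd≤even : suc (2 * d) ≤ 2 * suc d
    odd≤even = ≤-trans (n≤1+n _) (≤-reflexive (sym (*-suc 2 d)))
    collect : ∀ κ d k e → 2 * suc d * (2 * suc d) * (κ * (suc d * suc d) * (k * e))
                          ≡ 4 * κ * (suc d * (suc d * (suc d * (suc d * 1)))) * (k * e)
    collect = solve-∀

lemma4p16 : (c p q L : ℕ) → 0 < c → 0 < p → p < q →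
    ∃[ C ] ∃[ k ] ((G : Graph) → ModifiedPlanar G →
    (T : Tree G) → IsSeparatorTree G c p q L T →
    (K : ℕ) (𝓗 : List (List Bool)) → Unique 𝓗 → All (IsNode G T) 𝓗 → length 𝓗 ≡ K →
    pathCost G T 𝓗 * pathCost G T 𝓗 ≤ C * m G * K * (suc ⌈log₂ m G ⌉) ^ k)
lemma4p16 c p q L _ 0<p p<q = 4 * κ * suc p ^ 4 , 4 , bound
  where
  κ = mass-constant c L
  bound : (G : Graph) → ModifiedPlanar G → (T : Tree G) → IsSeparatorTree G c p q L T →
    (K : ℕ) (𝓗 : List (List Bool)) → Unique 𝓗 → All (IsNode G T) 𝓗 → length 𝓗 ≡ K →
    pathCost G T 𝓗 * pathCost G T 𝓗 ≤ 4 * κ * suc p ^ 4 * m G * K * (suc ⌈log₂ m G ⌉) ^ 4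
  bound G _ T (region≡⊤ , valid) K 𝓗 _ _ refl = begin
    pathCost G T 𝓗 * pathCost G T 𝓗     ≤⟨ pathCost²≤ G c p q L T d 𝓗 valid budget ⟩
    4 * κ * suc d ^ 4 * (K * ∣ region G T ∣) ≡⟨ cong (λ e → 4 * κ * suc d ^ 4 * (K * e)) ∣E∣≡m ⟩
    4 * κ * suc d ^ 4 * (K * m G)        ≤⟨ *-monoˡ-≤ (K * m G) (*-monoʳ-≤ (4 * κ) (^-monoˡ-≤ 4 d<[1+p]*t)) ⟩
    4 * κ * (suc p * t) ^ 4 * (K * m G)  ≡⟨ rearrange (4 * κ) (suc p) t K (m G) ⟩
    4 * κ * suc p ^ 4 * m G * K * t ^ 4  ∎
    where
    open ≤-Reasoning
    t = suc ⌈log₂ m G ⌉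
    d = p * t
    ∣E∣≡m : ∣ region G T ∣ ≡ m G
    ∣E∣≡m = trans (cong ∣_∣ region≡⊤) (∣⊤∣≡n (m G))
    budget : p ^ d * ∣ region G T ∣ < q ^ d
    budget = subst (λ e → p ^ d * e < q ^ d) (sym ∣E∣≡m) (depth-budget p q (m G) 0<p p<q)
    d<[1+p]*t : suc d ≤ suc p * t
    d<[1+p]*t = +-monoˡ-≤ d (s≤s z≤n)
    rearrange : ∀ a P t K m → a * (P * t * (P * t * (P * t * (P * t * 1)))) * (K * m)
                              ≡ a * (P * (P * (P * (P * 1)))) * m * K * (t * (t * (t * (t * 1))))
    rearrange = solve-∀
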